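{- Let $d<n$ be positive integers with $d\equiv r \pmod 2$ for some $r\in\{0,1\}$. For every family $\mathcal{A}\subset 2^{[n]}$ with $\mathrm{VC}(\mathcal{A}\triangle\mathcal{A})\le d$, we have $|\mathcal{A}|\le 2^r\binom{n-r}{\le \lfloor d/2\rfloor}$.
   Context: $[n]=\{1,\dots,n\}$. For a family $\mathcal{F}\subset 2^{[n]}$, a set $Y\subset[n]$ is shattered by $\mathcal{F}$ if $\{S\cap Y: S\in\mathcal{F}\}=2^Y$; $\mathrm{VC}(\mathcal{F})$ is the largest cardinality of a set shattered by $\mathcal{F}$. $\triangle$ denotes symmetric difference and $\mathcal{A}\triangle\mathcal{A}=\{S\triangle T: S,T\in\mathcal{A}\}$. $\binom{m}{\le t}=\sum_{j=0}^{t}\binom{m}{j}$. -}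

module Defs where

open import Data.Nat using (ℕ; zero; suc; _+_)
open import Data.Nat.Combinatorics using (_C_)
open import Data.Bool using (_xor_)
open import Data.Vec using (zipWith)
open import Data.Fin.Subset using (Subset; _⊆_; _∩_; ∣_∣)
open import Data.List using (List)
open import Data.List.Membership.Propositional using (_∈_)
open import Data.Product using (Σ; _×_; ∃₂)
open import Relation.Binary.PropositionalEquality using (_≡_)
open import Data.Nat using (_≤_)

_△_ : ∀ {n} → Subset n → Subset n → Subset n
_△_ = zipWith _xor_

_∈△△_ : ∀ {n} → Subset n → List (Subset n) → Set
U ∈△△ 𝒜 = ∃₂ λ S T → S ∈ 𝒜 × T ∈ 𝒜 × U ≡ S △ T

Shattered : ∀ {n} → (Subset n → Set) → Subset n → Set
Shattered {n} 𝓕 Y = (Z : Subset n) → Z ⊆ Y → Σ (Subset n) λ S → 𝓕 S × S ∩ Y ≡ Z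

VC≤ : ∀ {n} → (Subset n → Set) → ℕ → Set
VC≤ {n} 𝓕 d = (Y : Subset n) → Shattered 𝓕 Y → ∣ Y ∣ ≤ d

choose≤ : ℕ → ℕ → ℕ
choose≤ m zero = m C 0
choose≤ m (suc t) = choose≤ m t + m C suc t

module Submission where

open import Defs
open import Data.Nat using (ℕ; _+_; _*_; _∸_; _^_; _≤_; _<_; _/_)
open import Data.Nat.DivMod using (_%_)
open import Data.Fin.Subset using (Subset)
open import Data.List using (List; length)
open import Data.List.Relation.Unary.Unique.Propositional using (Unique)
open import Relation.Binary.PropositionalEquality using (_≡_)

open import Data.Nat using (zero; suc; z≤n; s≤s; _≟_)
open import Data.Nat.Properties
open import Data.Nat.DivMod using (m≡m%n+[m/n]*n; m%n<n; m/n≡1+[m∸n]/n)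
open import Data.Nat.Combinatorics using (_C_; nCk+nC[k+1]≡[n+1]C[k+1]; nCk≡nC[n∸k])
open import Data.Nat.Solver using (module +-*-Solver)
open import Data.Bool using (Bool; true; false; _xor_; _∧_; _∨_; not; if_then_else_)
import Data.Bool.Properties as Boolₚ
open import Data.Fin using (Fin; zero; suc)
open import Data.Fin.Subset using (_∩_; _∪_; ∁; ∣_∣; _⊆_)
open import Data.Fin.Subset.Properties using (∪-comm; drop-there)
open import Data.Vec using ([]; _∷_; lookup; tabulate; _[_]≔_; _[_]=_; here; there)
import Data.Vec.Properties as Vecₚ
open import Data.List using ([]; _∷_; map; allFin)
import Data.List.Properties as Listₚ
open import Data.List.Membership.Propositional using (_∈_; _∉_)
open import Data.List.Membership.Propositional.Properties using (∈-map⁺; ∈-map⁻; ∈-allFin)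
open import Data.List.Relation.Unary.Any using (here; there; any?)
open import Data.List.Relation.Unary.All as All using (All; []; _∷_)
import Data.List.Relation.Unary.All.Properties as Allₚ
open import Data.List.Relation.Unary.AllPairs using ([]; _∷_)
open import Data.List.Relation.Unary.Unique.Propositional.Properties using (allFin⁺)
open import Data.Product using (Σ; ∃; _×_; _,_; proj₂)
open import Data.Sum using (_⊎_; inj₁; inj₂)
open import Data.Empty using (⊥; ⊥-elim)
open import Relation.Nullary using (Dec; yes; no)
open import Relation.Binary.PropositionalEquality
  using (refl; sym; trans; cong; cong₂; subst; subst₂; _≢_; module ≡-Reasoning)
open import Function using (_∘_)
open +-*-Solver

-- Proof.  (1) Down-shifts.  The down-shift in direction i removes i from each
-- member unless the smaller set is already present.  It preserves |𝒜| and
-- never increases VC(𝒜 △ 𝒜) (shattered-back); after one shift in every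
-- direction the family is down-closed, hence closed under intersections.
-- (2) Unions.  For a down-closed 𝒜 and S, T ∈ 𝒜 the set S ∪ T is shattered by
-- 𝒜 △ 𝒜, since Z ⊆ S ∪ T is traced by (S ∩ Z) △ (T ∩ Z ∖ S); so |S ∪ T| ≤ d.
-- (3) Kleitman's theorem.  A family on m + 1 points with pairwise unions of
-- size ≤ d ≤ m has at most 2^r · (m + 1 - r choose ≤ ⌊d/2⌋) members, r = d mod 2.
-- For d = m this is the "no complementary pair" bound 2^m.  For d < m we
-- up-shift the first point to every other coordinate and split by the first
-- point: the sets avoiding it satisfy the bound d, those containing it the
-- bound d - 2, and the bound obeys Pascal's rule.

_≟ₛ_ : ∀ {n} (x y : Subset n) → Dec (x ≡ y)
_≟ₛ_ = Vecₚ.≡-dec Boolₚ._≟_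

_∈?_ : ∀ {n} (x : Subset n) (𝒜 : List (Subset n)) → Dec (x ∈ 𝒜)
x ∈? 𝒜 = any? (x ≟ₛ_) 𝒜

≡-pointwise : ∀ {n} {u v : Subset n} → (∀ k → lookup u k ≡ lookup v k) → u ≡ v
≡-pointwise {u = u} {v} h = begin
  u                  ≡⟨ sym (Vecₚ.tabulate∘lookup u) ⟩
  tabulate (lookup u) ≡⟨ Vecₚ.tabulate-cong h ⟩
  tabulate (lookup v) ≡⟨ Vecₚ.tabulate∘lookup v ⟩
  v                  ∎
  where open ≡-Reasoning

map-unique : ∀ {X Y : Set} (f : X → Y) (xs : List X) → Unique xs →
  (∀ {x y} → x ∈ xs → y ∈ xs → f x ≡ f y → x ≡ y) → Unique (map f xs)
map-unique f [] [] inj = []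
map-unique f (x ∷ xs) (x∉xs ∷ xs!) inj =
  Allₚ.map⁺ (All.tabulate λ y∈xs fx≡fy → All.lookup x∉xs y∈xs (inj (here refl) (there y∈xs) fx≡fy))
  ∷ map-unique f xs xs! (λ x∈ y∈ → inj (there x∈) (there y∈))

lookup-△∩ : ∀ {n} (S T Y : Subset n) k →
  lookup ((S △ T) ∩ Y) k ≡ (lookup S k xor lookup T k) ∧ lookup Y k
lookup-△∩ S T Y k = trans (Vecₚ.lookup-zipWith _∧_ k (S △ T) Y)
  (cong (_∧ lookup Y k) (Vecₚ.lookup-zipWith _xor_ k S T))

lookup-∪ : ∀ {n} (k : Fin n) (S U : Subset n) → lookup (S ∪ U) k ≡ lookup S k ∨ lookup U k
lookup-∪ k S U = Vecₚ.lookup-zipWith _∨_ k S U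

clear : ∀ {n} → Fin n → Subset n → Subset n
clear i S = S [ i ]≔ false

insert : ∀ {n} → Fin n → Subset n → Subset n
insert i S = S [ i ]≔ true

lookup-clear : ∀ {n} (i : Fin n) (S : Subset n) → lookup (clear i S) i ≡ false
lookup-clear i S = Vecₚ.lookup∘update i S false

clear-set : ∀ {n} (i : Fin n) (S : Subset n) b → clear i (S [ i ]≔ b) ≡ clear i S
clear-set i S b = Vecₚ.[]≔-idempotent S i

clear-idem : ∀ {n} (i : Fin n) (S : Subset n) → clear i (clear i S) ≡ clear i S
clear-idem i S = clear-set i S false

clear-absent : ∀ {n} (i : Fin n) (S : Subset n) → lookup S i ≡ false → clear i S ≡ S
clear-absent i S Sᵢ≡false = trans (cong (S [ i ]≔_) (sym Sᵢ≡false)) (Vecₚ.[]≔-lookup S i)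

clear-comm : ∀ {n} (i j : Fin n) (S : Subset n) → clear i (clear j S) ≡ clear j (clear i S)
clear-comm zero zero (x ∷ S) = refl
clear-comm zero (suc j) (x ∷ S) = refl
clear-comm (suc i) zero (x ∷ S) = refl
clear-comm (suc i) (suc j) (x ∷ S) = cong (x ∷_) (clear-comm i j S)

≡-via-clear : ∀ {n} (i : Fin n) {S T : Subset n} →
  clear i S ≡ clear i T → lookup S i ≡ lookup T i → S ≡ T
≡-via-clear zero {x ∷ S} {y ∷ T} off at = cong₂ _∷_ at (Vecₚ.∷-injectiveʳ off)
≡-via-clear (suc i) {x ∷ S} {y ∷ T} off at =
  cong₂ _∷_ (Vecₚ.∷-injectiveˡ off) (≡-via-clear i (Vecₚ.∷-injectiveʳ off) at)

clear-△ : ∀ {n} (i : Fin n) (S T : Subset n) → clear i (S △ T) ≡ clear i S △ clear i T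
clear-△ zero (x ∷ S) (y ∷ T) = refl
clear-△ (suc i) (x ∷ S) (y ∷ T) = cong ((x xor y) ∷_) (clear-△ i S T)

clear-∩ : ∀ {n} (i : Fin n) (U Y : Subset n) → clear i (U ∩ Y) ≡ clear i U ∩ Y
clear-∩ zero (x ∷ U) (y ∷ Y) = refl
clear-∩ (suc i) (x ∷ U) (y ∷ Y) = cong ((x ∧ y) ∷_) (clear-∩ i U Y)

clear-△∩ : ∀ {n} (i : Fin n) {S S′ T T′ : Subset n} (Y : Subset n) →
  clear i S ≡ clear i S′ → clear i T ≡ clear i T′ →
  clear i ((S △ T) ∩ Y) ≡ clear i ((S′ △ T′) ∩ Y)
clear-△∩ i {S} {S′} {T} {T′} Y eS eT = begin
  clear i ((S △ T) ∩ Y)             ≡⟨ clear-∩ i (S △ T) Y ⟩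
  clear i (S △ T) ∩ Y               ≡⟨ cong (_∩ Y) (clear-△ i S T) ⟩
  (clear i S △ clear i T) ∩ Y       ≡⟨ cong₂ (λ u v → (u △ v) ∩ Y) eS eT ⟩
  (clear i S′ △ clear i T′) ∩ Y     ≡⟨ cong (_∩ Y) (sym (clear-△ i S′ T′)) ⟩
  clear i (S′ △ T′) ∩ Y             ≡⟨ sym (clear-∩ i (S′ △ T′) Y) ⟩
  clear i ((S′ △ T′) ∩ Y)           ∎
  where open ≡-Reasoning

clash : ∀ {A : Set} {b : Bool} → b ≡ true → b ≡ false → A
clash refl ()

⊆-insert : ∀ {n} {i : Fin n} {Z Y : Subset n} → Z ⊆ Y → lookup Y i ≡ true → insert i Z ⊆ Y
⊆-insert {i = zero} {_ ∷ Z} {_ ∷ Y} Z⊆Y Yᵢ here = subst (λ y → (y ∷ Y) [ zero ]= true) (sym Yᵢ) here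
⊆-insert {i = zero} {_ ∷ Z} {_ ∷ Y} Z⊆Y Yᵢ (there k∈) = Z⊆Y (there k∈)
⊆-insert {i = suc i} {_ ∷ Z} {_ ∷ Y} Z⊆Y Yᵢ here = Z⊆Y here
⊆-insert {i = suc i} {_ ∷ Z} {_ ∷ Y} Z⊆Y Yᵢ (there k∈) =
  there (⊆-insert (λ k∈Z → drop-there (Z⊆Y (there k∈Z))) Yᵢ k∈)

module Compression {n : ℕ} (movable : Subset n → Bool) (push : Subset n → Subset n) where

  compress : List (Subset n) → Subset n → Subset n
  compress 𝒜 S with movable S | push S ∈? 𝒜
  ... | true | no _ = push S
  ... | _    | _    = S

  compressAll : List (Subset n) → List (Subset n)
  compressAll 𝒜 = map (compress 𝒜) 𝒜

  data Outcome (𝒜 : List (Subset n)) (S C : Subset n) : Set where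
    stays : C ≡ S → (movable S ≡ true → push S ∈ 𝒜) → Outcome 𝒜 S C
    moves : C ≡ push S → movable S ≡ true → push S ∉ 𝒜 → Outcome 𝒜 S C

  outcome : ∀ 𝒜 S → Outcome 𝒜 S (compress 𝒜 S)
  outcome 𝒜 S with movable S in mv | push S ∈? 𝒜
  ... | false | _        = stays refl (λ m → clash m mv)
  ... | true  | yes p∈𝒜 = stays refl (λ _ → p∈𝒜)
  ... | true  | no  p∉𝒜 = moves refl mv p∉𝒜

  length-compressAll : ∀ 𝒜 → length (compressAll 𝒜) ≡ length 𝒜
  length-compressAll 𝒜 = Listₚ.length-map (compress 𝒜) 𝒜

  module _ (push-injective : ∀ {S T} → movable S ≡ true → movable T ≡ true → push S ≡ push T → S ≡ T)
           (𝒜 : List (Subset n)) where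

    compress-injective : ∀ {S T} → S ∈ 𝒜 → T ∈ 𝒜 → compress 𝒜 S ≡ compress 𝒜 T → S ≡ T
    compress-injective {S} {T} S∈ T∈ eq with outcome 𝒜 S | outcome 𝒜 T
    ... | stays eS _ | stays eT _ = trans (sym eS) (trans eq eT)
    ... | moves eS mS _ | moves eT mT _ = push-injective mS mT (trans (sym eS) (trans eq eT))
    ... | stays eS _ | moves eT _ pT∉ = ⊥-elim (pT∉ (subst (_∈ 𝒜) (trans (sym eS) (trans eq eT)) S∈))
    ... | moves eS _ pS∉ | stays eT _ = ⊥-elim (pS∉ (subst (_∈ 𝒜) (trans (sym eT) (trans (sym eq) eS)) T∈))

    unique-compressAll : Unique 𝒜 → Unique (compressAll 𝒜)
    unique-compressAll 𝒜! = map-unique (compress 𝒜) 𝒜 𝒜! compress-injective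

  stays-in : ∀ {𝒜 S} → S ∈ 𝒜 → (movable S ≡ true → push S ∈ 𝒜) → S ∈ compressAll 𝒜
  stays-in {𝒜} {S} S∈ h with outcome 𝒜 S
  ... | stays eS _ = subst (_∈ compressAll 𝒜) eS (∈-map⁺ (compress 𝒜) S∈)
  ... | moves _ mS pS∉ = ⊥-elim (pS∉ (h mS))

  preimage : ∀ {𝒜 X} → X ∈ compressAll 𝒜 →
    X ∈ 𝒜 ⊎ ∃ λ S → S ∈ 𝒜 × movable S ≡ true × X ≡ push S
  preimage {𝒜} X∈ with ∈-map⁻ (compress 𝒜) X∈
  ... | S , S∈ , refl with outcome 𝒜 S
  ...   | stays eS _ = inj₁ (subst (_∈ 𝒜) (sym eS) S∈)
  ...   | moves eS mS _ = inj₂ (S , S∈ , mS , eS)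

  module _ (push-immovable : ∀ S → movable (push S) ≡ false) where

    pushed-in : ∀ {𝒜 S} → S ∈ 𝒜 → movable S ≡ true → push S ∈ compressAll 𝒜
    pushed-in {𝒜} {S} S∈ mS with outcome 𝒜 S
    ... | stays _ pS∈ = stays-in (pS∈ mS) (λ mpS → clash mpS (push-immovable S))
    ... | moves eS _ _ = subst (_∈ compressAll 𝒜) eS (∈-map⁺ (compress 𝒜) S∈)

    movable-member : ∀ {𝒜 X} → X ∈ compressAll 𝒜 → movable X ≡ true → X ∈ 𝒜 × push X ∈ 𝒜
    movable-member {𝒜} X∈ mX with ∈-map⁻ (compress 𝒜) X∈
    ... | S , S∈ , refl with outcome 𝒜 S
    ...   | stays eS pS∈ rewrite eS = S∈ , pS∈ mX
    ...   | moves eS _ _ = clash (trans (cong movable (sym eS)) mX) (push-immovable S)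

    compressAll-pushed : ∀ {𝒜 X} → X ∈ compressAll 𝒜 → movable X ≡ true → push X ∈ compressAll 𝒜
    compressAll-pushed X∈ mX = stays-in (proj₂ (movable-member X∈ mX)) (λ mpX → clash mpX (push-immovable _))

iterate : ∀ {I L : Set} → (I → L → L) → List I → L → L
iterate f [] A = A
iterate f (i ∷ is) A = iterate f is (f i A)

iterate-invariant : ∀ {I L : Set} (f : I → L → L) (P : L → Set) →
  (∀ i {A} → P A → P (f i A)) → ∀ is {A} → P A → P (iterate f is A)
iterate-invariant f P keep [] PA = PA
iterate-invariant f P keep (i ∷ is) PA = iterate-invariant f P keep is (keep i PA)

iterate-stable : ∀ {I L : Set} (f : I → L → L) (Stable : I → L → Set) →
  (∀ i A → Stable i (f i A)) → (∀ i j {A} → Stable j A → Stable j (f i A)) →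
  ∀ is A {j} → j ∈ is → Stable j (iterate f is A)
iterate-stable f Stable est keep (i ∷ is) A (here refl) =
  iterate-invariant f (Stable i) (λ k → keep k i) is (est i A)
iterate-stable f Stable est keep (i ∷ is) A (there j∈) = iterate-stable f Stable est keep is (f i A) j∈

DownClosedAt : ∀ {n} → Fin n → List (Subset n) → Set
DownClosedAt i 𝒜 = ∀ {X} → X ∈ 𝒜 → clear i X ∈ 𝒜

module DownShift {n : ℕ} (i : Fin n) where
  open Compression (λ S → lookup S i) (clear i)

  downShift : List (Subset n) → List (Subset n)
  downShift = compressAll

  length-downShift : ∀ 𝒜 → length (downShift 𝒜) ≡ length 𝒜
  length-downShift = length-compressAll

  unique-downShift : ∀ 𝒜 → Unique 𝒜 → Unique (downShift 𝒜)
  unique-downShift = unique-compressAll (λ Sᵢ Tᵢ eq → ≡-via-clear i eq (trans Sᵢ (sym Tᵢ)))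

  clear-compress : ∀ 𝒜 S → clear i (compress 𝒜 S) ≡ clear i S
  clear-compress 𝒜 S with outcome 𝒜 S
  ... | stays eS _   = cong (clear i) eS
  ... | moves eS _ _ = trans (cong (clear i) eS) (clear-idem i S)

  shadow : ∀ {𝒜 X} → X ∈ downShift 𝒜 → ∃ λ S → S ∈ 𝒜 × clear i X ≡ clear i S
  shadow {𝒜} X∈ with ∈-map⁻ (compress 𝒜) X∈
  ... | S , S∈ , refl = S , S∈ , clear-compress 𝒜 S

  cleared-in : ∀ {𝒜 S} → S ∈ 𝒜 → clear i S ∈ downShift 𝒜
  cleared-in {𝒜} {S} S∈ with lookup S i in Sᵢ
  ... | true  = pushed-in (lookup-clear i) S∈ Sᵢ
  ... | false = subst (_∈ downShift 𝒜) (sym (clear-absent i S Sᵢ)) (stays-in S∈ (λ Sᵢ′ → clash Sᵢ′ Sᵢ))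

  stayer-cleared : ∀ {𝒜 S} → S ∈ 𝒜 → (lookup S i ≡ true → clear i S ∈ 𝒜) → clear i S ∈ 𝒜
  stayer-cleared {𝒜} {S} S∈ h with lookup S i in Sᵢ
  ... | true  = h refl
  ... | false = subst (_∈ 𝒜) (sym (clear-absent i S Sᵢ)) S∈

  closes : ∀ 𝒜 → DownClosedAt i (downShift 𝒜)
  closes 𝒜 X∈ with shadow X∈
  ... | S , S∈ , eq = subst (_∈ downShift 𝒜) (sym eq) (cleared-in S∈)

  keeps : ∀ j {𝒜} → DownClosedAt j 𝒜 → DownClosedAt j (downShift 𝒜)
  keeps j {𝒜} closed X∈ with ∈-map⁻ (compress 𝒜) X∈
  ... | S , S∈ , refl with outcome 𝒜 S
  ...   | stays eS pS∈ = subst (λ Z → clear j Z ∈ downShift 𝒜) (sym eS)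
            (stays-in (closed S∈) (λ _ → subst (_∈ 𝒜) (clear-comm j i S) (closed (stayer-cleared S∈ pS∈))))
  ...   | moves eS _ _ = subst (λ Z → clear j Z ∈ downShift 𝒜) (sym eS)
            (subst (_∈ downShift 𝒜) (clear-comm i j S) (cleared-in (closed S∈)))

  adjust : ∀ {𝒜 : List (Subset n)} {S} → lookup S i ≡ true → S ∈ 𝒜 → clear i S ∈ 𝒜 → ∀ b →
    ∃ λ x → x ∈ 𝒜 × clear i x ≡ clear i S × lookup x i ≡ b
  adjust {S = S} Sᵢ S∈ cS∈ true  = S , S∈ , refl , Sᵢ
  adjust {S = S} Sᵢ S∈ cS∈ false = clear i S , cS∈ , clear-idem i S , lookup-clear i S

  -- The case i ∈ Y of shattering: a shifted pair P ∋ i, Q tracing Z on Y off i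
  -- is replaced by an old pair tracing Z on all of Y.
  realise : ∀ {𝒜 P Q} (Y Z : Subset n) → P ∈ downShift 𝒜 → Q ∈ downShift 𝒜 →
    lookup P i ≡ true → lookup Y i ≡ true → clear i ((P △ Q) ∩ Y) ≡ clear i Z →
    Σ (Subset n) λ U → U ∈△△ 𝒜 × U ∩ Y ≡ Z
  realise {𝒜} {P} {Q} Y Z P∈ Q∈ Pᵢ Yᵢ off
    with movable-member (lookup-clear i) P∈ Pᵢ | shadow Q∈
  ... | P∈𝒜 , cP∈𝒜 | X , X∈ , eX with adjust Pᵢ P∈𝒜 cP∈𝒜 (lookup Z i xor lookup X i)
  ...   | x , x∈ , cx , xᵢ = x △ X , (x , X , x∈ , X∈ , refl) , ≡-via-clear i offEq atEq
    where
      offEq : clear i ((x △ X) ∩ Y) ≡ clear i Z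
      offEq = trans (clear-△∩ i Y cx (sym eX)) off
      atEq : lookup ((x △ X) ∩ Y) i ≡ lookup Z i
      atEq = begin
        lookup ((x △ X) ∩ Y) i                         ≡⟨ lookup-△∩ x X Y i ⟩
        (lookup x i xor lookup X i) ∧ lookup Y i       ≡⟨ cong₂ (λ a y → (a xor lookup X i) ∧ y) xᵢ Yᵢ ⟩
        ((lookup Z i xor lookup X i) xor lookup X i) ∧ true ≡⟨ xor-cancel (lookup Z i) (lookup X i) ⟩
        lookup Z i                                     ∎
        where open ≡-Reasoning
              xor-cancel : ∀ z x → ((z xor x) xor x) ∧ true ≡ z
              xor-cancel true true = refl
              xor-cancel true false = refl
              xor-cancel false true = refl
              xor-cancel false false = refl

  -- A shifted pair tracing Z ∪ {i} on Y: exactly one member contains i;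
  -- put it first and apply realise.
  realise-insert : ∀ {𝒜 S′ T′} (Y Z : Subset n) → S′ ∈ downShift 𝒜 → T′ ∈ downShift 𝒜 →
    lookup Y i ≡ true → clear i ((S′ △ T′) ∩ Y) ≡ clear i Z → lookup ((S′ △ T′) ∩ Y) i ≡ true →
    Σ (Subset n) λ U → U ∈△△ 𝒜 × U ∩ Y ≡ Z
  realise-insert {S′ = S′} {T′} Y Z S′∈ T′∈ Yᵢ off at with lookup S′ i in S′ᵢ | lookup T′ i in T′ᵢ
  ... | true  | _     = realise Y Z S′∈ T′∈ S′ᵢ Yᵢ off
  ... | false | true  = realise Y Z T′∈ S′∈ T′ᵢ Yᵢ
                          (trans (cong (λ U → clear i (U ∩ Y)) (Vecₚ.zipWith-comm Boolₚ.xor-comm T′ S′)) off)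
  ... | false | false = clash at (trans (lookup-△∩ S′ T′ Y i) (cong₂ (λ a b → (a xor b) ∧ lookup Y i) S′ᵢ T′ᵢ))

  shattered-back : ∀ {𝒜} Y → Shattered (_∈△△ downShift 𝒜) Y → Shattered (_∈△△ 𝒜) Y
  shattered-back {𝒜} Y sh Z Z⊆Y with lookup Y i in Yᵢ
  ... | true with sh (insert i Z) (⊆-insert Z⊆Y Yᵢ)
  ...   | _ , (S′ , T′ , S′∈ , T′∈ , refl) , trace =
    realise-insert Y Z S′∈ T′∈ Yᵢ (trans (cong (clear i) trace) (clear-set i Z true))
      (trans (cong (λ U → lookup U i) trace) (Vecₚ.lookup∘update i Z true))
  shattered-back {𝒜} Y sh Z Z⊆Y | false with sh Z Z⊆Y
  ...   | _ , (S′ , T′ , S′∈ , T′∈ , refl) , trace with shadow S′∈ | shadow T′∈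
  ...     | S , S∈ , eS | T , T∈ , eT = S △ T , (S , T , S∈ , T∈ , refl) , trans sameTrace trace
    where
      outside : ∀ U V → lookup ((U △ V) ∩ Y) i ≡ false
      outside U V = trans (lookup-△∩ U V Y i) (trans (cong (_ ∧_) Yᵢ) (Boolₚ.∧-zeroʳ _))
      sameTrace : (S △ T) ∩ Y ≡ (S′ △ T′) ∩ Y
      sameTrace = ≡-via-clear i (clear-△∩ i Y (sym eS) (sym eT)) (trans (outside S T) (sym (outside S′ T′)))

  vc-downShift : ∀ {𝒜 d} → VC≤ (_∈△△ 𝒜) d → VC≤ (_∈△△ downShift 𝒜) d
  vc-downShift vc Y sh = vc Y (shattered-back Y sh)

DownClosed : ∀ {n} → List (Subset n) → Set
DownClosed {n} 𝒜 = ∀ i → DownClosedAt i 𝒜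

downShiftAll : ∀ {n} → List (Subset n) → List (Subset n)
downShiftAll {n} = iterate DownShift.downShift (allFin n)

module _ {n : ℕ} where
  open DownShift

  length-downShiftAll : ∀ (𝒜 : List (Subset n)) → length (downShiftAll 𝒜) ≡ length 𝒜
  length-downShiftAll 𝒜 = iterate-invariant downShift (λ ℬ → length ℬ ≡ length 𝒜)
    (λ i {ℬ} eq → trans (length-downShift i ℬ) eq) (allFin n) refl

  unique-downShiftAll : ∀ (𝒜 : List (Subset n)) → Unique 𝒜 → Unique (downShiftAll 𝒜)
  unique-downShiftAll 𝒜 = iterate-invariant downShift Unique (λ i {ℬ} → unique-downShift i ℬ) (allFin n)

  vc-downShiftAll : ∀ {𝒜 : List (Subset n)} {d} → VC≤ (_∈△△ 𝒜) d → VC≤ (_∈△△ downShiftAll 𝒜) d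
  vc-downShiftAll {d = d} = iterate-invariant downShift (λ ℬ → VC≤ (_∈△△ ℬ) d) (λ i → vc-downShift i) (allFin n)

  -- After a down-shift in every direction the family is down-closed,
  -- since each shift establishes its own closure and keeps the others.
  downClosed-downShiftAll : ∀ (𝒜 : List (Subset n)) → DownClosed (downShiftAll 𝒜)
  downClosed-downShiftAll 𝒜 j =
    iterate-stable downShift DownClosedAt closes (λ i j → keeps i j) (allFin n) 𝒜 (∈-allFin j)

-- A down-closed family is closed under intersection with any set M: X ∩ M
-- arises from X by removing the elements outside M one coordinate at a time.
module Trim {n : ℕ} (M : Subset n) where

  trim : Fin n → Subset n → Subset n
  trim j X = if lookup M j then X else clear j X

  trim-in : ∀ {𝒜} → DownClosed 𝒜 → ∀ j {X} → X ∈ 𝒜 → trim j X ∈ 𝒜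
  trim-in closed j {X} X∈ with lookup M j
  ... | true  = X∈
  ... | false = closed j X∈

  lookup-trim-off : ∀ j X k → j ≢ k → lookup (trim j X) k ≡ lookup X k
  lookup-trim-off j X k j≢k with lookup M j
  ... | true  = refl
  ... | false = Vecₚ.lookup∘update′ (j≢k ∘ sym) X false

  lookup-trim-at : ∀ k X → lookup (trim k X) k ≡ lookup X k ∧ lookup M k
  lookup-trim-at k X with lookup M k
  ... | true  = sym (Boolₚ.∧-identityʳ _)
  ... | false = trans (lookup-clear k X) (sym (Boolₚ.∧-zeroʳ _))

  lookup-trims-off : ∀ js X k → All (k ≢_) js → lookup (iterate trim js X) k ≡ lookup X k
  lookup-trims-off [] X k _ = refl
  lookup-trims-off (j ∷ js) X k (k≢j ∷ k∉js) =
    trans (lookup-trims-off js (trim j X) k k∉js) (lookup-trim-off j X k (k≢j ∘ sym))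

  lookup-trims-at : ∀ js X k → k ∈ js → Unique js → lookup (iterate trim js X) k ≡ lookup X k ∧ lookup M k
  lookup-trims-at (j ∷ js) X k (here refl) (k∉js ∷ _) =
    trans (lookup-trims-off js (trim k X) k k∉js) (lookup-trim-at k X)
  lookup-trims-at (j ∷ js) X k (there k∈js) (j∉js ∷ js!) =
    trans (lookup-trims-at js (trim j X) k k∈js js!)
          (cong (_∧ lookup M k) (lookup-trim-off j X k (λ j≡k → All.lookup j∉js k∈js j≡k)))

  ∩-closed : ∀ {𝒜} → DownClosed 𝒜 → ∀ {X} → X ∈ 𝒜 → X ∩ M ∈ 𝒜
  ∩-closed {𝒜} closed {X} X∈ = subst (_∈ 𝒜) (≡-pointwise trimmed)
    (iterate-invariant trim (_∈ 𝒜) (trim-in closed) (allFin n) X∈)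
    where
      trimmed : ∀ k → lookup (iterate trim (allFin n) X) k ≡ lookup (X ∩ M) k
      trimmed k = trans (lookup-trims-at (allFin n) X k (∈-allFin k) (allFin⁺ n))
                        (sym (Vecₚ.lookup-zipWith _∧_ k X M))

open Trim using (∩-closed)

UnionBounded : ∀ {n} → List (Subset n) → ℕ → Set
UnionBounded 𝒜 d = ∀ {S T} → S ∈ 𝒜 → T ∈ 𝒜 → ∣ S ∪ T ∣ ≤ d

-- For S, T in a down-closed family, S ∪ T is shattered by 𝒜 △ 𝒜: the subset
-- Z ⊆ S ∪ T is traced by (S ∩ Z) △ (T ∩ Z ∖ S).  Hence VC(𝒜 △ 𝒜) ≤ d bounds unions.
unionBounded-fromVC : ∀ {n} {𝒜 : List (Subset n)} {d} → DownClosed 𝒜 →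
  VC≤ (_∈△△ 𝒜) d → UnionBounded 𝒜 d
unionBounded-fromVC {n} {𝒜} closed vc {S} {T} S∈ T∈ = vc (S ∪ T) shattered
  where
    shattered : Shattered (_∈△△ 𝒜) (S ∪ T)
    shattered Z Z⊆S∪T = P △ Q , (P , Q , ∩-closed Z closed S∈ , ∩-closed (Z ∩ ∁ S) closed T∈ , refl) ,
                        ≡-pointwise traced
      where
        P Q : Subset n
        P = S ∩ Z
        Q = T ∩ (Z ∩ ∁ S)
        bits : ∀ s t z → (z ≡ true → s ∨ t ≡ true) → ((s ∧ z) xor (t ∧ (z ∧ not s))) ∧ (s ∨ t) ≡ z
        bits true  true  true  _ = refl
        bits true  true  false _ = refl
        bits true  false true  _ = refl
        bits true  false false _ = refl
        bits false true  true  _ = refl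
        bits false true  false _ = refl
        bits false false true  h = h refl
        bits false false false _ = refl
        traced : ∀ k → lookup ((P △ Q) ∩ (S ∪ T)) k ≡ lookup Z k
        traced k rewrite lookup-△∩ P Q (S ∪ T) k | Vecₚ.lookup-zipWith _∧_ k S Z
                       | Vecₚ.lookup-zipWith _∧_ k T (Z ∩ ∁ S) | Vecₚ.lookup-zipWith _∧_ k Z (∁ S)
                       | Vecₚ.lookup-map k not S | Vecₚ.lookup-zipWith _∨_ k S T
          = bits (lookup S k) (lookup T k) (lookup Z k)
              (λ Zₖ → trans (sym (Vecₚ.lookup-zipWith _∨_ k S T))
                             (Vecₚ.[]=⇒lookup (Z⊆S∪T (Vecₚ.lookup⇒[]= k Z Zₖ))))

section : ∀ {m} → Bool → List (Subset (suc m)) → List (Subset m)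
section b [] = []
section false ((false ∷ s) ∷ 𝒜) = s ∷ section false 𝒜
section true  ((true  ∷ s) ∷ 𝒜) = s ∷ section true 𝒜
section false ((true  ∷ s) ∷ 𝒜) = section false 𝒜
section true  ((false ∷ s) ∷ 𝒜) = section true 𝒜

∈-section : ∀ {m} b {𝒜 : List (Subset (suc m))} {s} → s ∈ section b 𝒜 → (b ∷ s) ∈ 𝒜
∈-section false {(false ∷ _) ∷ 𝒜} (here refl) = here refl
∈-section false {(false ∷ _) ∷ 𝒜} (there s∈) = there (∈-section false s∈)
∈-section false {(true  ∷ _) ∷ 𝒜} s∈ = there (∈-section false s∈)
∈-section true  {(true  ∷ _) ∷ 𝒜} (here refl) = here refl
∈-section true  {(true  ∷ _) ∷ 𝒜} (there s∈) = there (∈-section true s∈)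
∈-section true  {(false ∷ _) ∷ 𝒜} s∈ = there (∈-section true s∈)

unique-section : ∀ {m} b (𝒜 : List (Subset (suc m))) → Unique 𝒜 → Unique (section b 𝒜)
unique-section b [] [] = []
unique-section false ((false ∷ s) ∷ 𝒜) (s∉ ∷ 𝒜!) =
  All.tabulate (λ t∈ s≡t → All.lookup s∉ (∈-section false t∈) (cong (false ∷_) s≡t)) ∷ unique-section false 𝒜 𝒜!
unique-section true ((true ∷ s) ∷ 𝒜) (s∉ ∷ 𝒜!) =
  All.tabulate (λ t∈ s≡t → All.lookup s∉ (∈-section true t∈) (cong (true ∷_) s≡t)) ∷ unique-section true 𝒜 𝒜!
unique-section false ((true  ∷ s) ∷ 𝒜) (_ ∷ 𝒜!) = unique-section false 𝒜 𝒜!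
unique-section true  ((false ∷ s) ∷ 𝒜) (_ ∷ 𝒜!) = unique-section true 𝒜 𝒜!

length-sections : ∀ {m} (𝒜 : List (Subset (suc m))) →
  length 𝒜 ≡ length (section false 𝒜) + length (section true 𝒜)
length-sections [] = refl
length-sections ((false ∷ s) ∷ 𝒜) = cong suc (length-sections 𝒜)
length-sections ((true  ∷ s) ∷ 𝒜) = trans (cong suc (length-sections 𝒜)) (sym (+-suc _ _))

length-unique₀ : (𝒜 : List (Subset 0)) → Unique 𝒜 → length 𝒜 ≤ 1
length-unique₀ [] _ = z≤n
length-unique₀ (_ ∷ []) _ = s≤s z≤n
length-unique₀ ([] ∷ [] ∷ 𝒜) ((≢ ∷ _) ∷ _) = ⊥-elim (≢ refl)

-- Induct on m, pairing the
-- section of ℬ at 1 with that of 𝒞 at 0, and vice versa.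
cross-bound : ∀ m (ℬ 𝒞 : List (Subset m)) → Unique ℬ → Unique 𝒞 →
  (∀ {s t} → s ∈ ℬ → t ∈ 𝒞 → ∣ s ∪ t ∣ < m) → length ℬ + length 𝒞 ≤ 2 ^ m
cross-bound zero [] 𝒞 _ 𝒞! _ = length-unique₀ 𝒞 𝒞!
cross-bound zero ℬ@(_ ∷ _) [] ℬ! _ _ = subst (_≤ 1) (sym (+-identityʳ _)) (length-unique₀ ℬ ℬ!)
cross-bound zero (_ ∷ _) (_ ∷ _) _ _ cross with cross (here refl) (here refl)
... | ()
cross-bound (suc m) ℬ 𝒞 ℬ! 𝒞! cross = begin
    length ℬ + length 𝒞
      ≡⟨ cong₂ _+_ (length-sections ℬ) (length-sections 𝒞) ⟩
    (b₀ + b₁) + (c₀ + c₁)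
      ≡⟨ solve 4 (λ a b c d → (a :+ b) :+ (c :+ d) := (b :+ c) :+ (a :+ d)) refl b₀ b₁ c₀ c₁ ⟩
    (b₁ + c₀) + (b₀ + c₁)
      ≤⟨ +-mono-≤ ℬ₁𝒞₀ ℬ₀𝒞₁ ⟩
    2 ^ m + 2 ^ m
      ≡⟨ cong (2 ^ m +_) (sym (+-identityʳ _)) ⟩
    2 ^ suc m ∎
  where
    open ≤-Reasoning
    b₀ b₁ c₀ c₁ : ℕ
    b₀ = length (section false ℬ)
    b₁ = length (section true ℬ)
    c₀ = length (section false 𝒞)
    c₁ = length (section true 𝒞)
    -- For sections at opposite first coordinates, that coordinate adds one to every union.
    ℬ₁𝒞₀ : b₁ + c₀ ≤ 2 ^ m
    ℬ₁𝒞₀ = cross-bound m (section true ℬ) (section false 𝒞) (unique-section true ℬ ℬ!)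
      (unique-section false 𝒞 𝒞!) (λ s∈ t∈ → ≤-pred (cross (∈-section true s∈) (∈-section false t∈)))
    ℬ₀𝒞₁ : b₀ + c₁ ≤ 2 ^ m
    ℬ₀𝒞₁ = cross-bound m (section false ℬ) (section true 𝒞) (unique-section false ℬ ℬ!)
      (unique-section true 𝒞 𝒞!) (λ s∈ t∈ → ≤-pred (cross (∈-section false s∈) (∈-section true t∈)))

unionBounded-full : ∀ m (𝒜 : List (Subset (suc m))) → Unique 𝒜 → UnionBounded 𝒜 m → length 𝒜 ≤ 2 ^ m
unionBounded-full m 𝒜 𝒜! bounded = begin
  length 𝒜                                              ≡⟨ length-sections 𝒜 ⟩
  length (section false 𝒜) + length (section true 𝒜)    ≡⟨ +-comm _ (length (section true 𝒜)) ⟩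
  length (section true 𝒜) + length (section false 𝒜)    ≤⟨ cross-bound m (section true 𝒜) (section false 𝒜)
      (unique-section true 𝒜 𝒜!) (unique-section false 𝒜 𝒜!)
      (λ s∈ t∈ → bounded (∈-section true s∈) (∈-section false t∈)) ⟩
  2 ^ m                                                 ∎
  where open ≤-Reasoning

∣insert∣ : ∀ {m} (j : Fin m) (w : Subset m) → lookup w j ≡ false → ∣ insert j w ∣ ≡ suc ∣ w ∣
∣insert∣ zero (false ∷ w) refl = refl
∣insert∣ (suc j) (true ∷ w) wⱼ = cong suc (∣insert∣ j w wⱼ)
∣insert∣ (suc j) (false ∷ w) wⱼ = ∣insert∣ j w wⱼ

insert-present : ∀ {m} (j : Fin m) (w : Subset m) → lookup w j ≡ true → insert j w ≡ w
insert-present j w wⱼ = trans (cong (w [ j ]≔_) (sym wⱼ)) (Vecₚ.[]≔-lookup w j)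

insert-∪ˡ : ∀ {m} (j : Fin m) (s u : Subset m) → insert j s ∪ u ≡ insert j (s ∪ u)
insert-∪ˡ zero (x ∷ s) (y ∷ u) = refl
insert-∪ˡ (suc j) (x ∷ s) (y ∷ u) = cong ((x ∨ y) ∷_) (insert-∪ˡ j s u)

insert-∪ʳ : ∀ {m} (j : Fin m) (s u : Subset m) → s ∪ insert j u ≡ insert j (s ∪ u)
insert-∪ʳ zero (x ∷ s) (y ∷ u) = cong (_∷ _) (Boolₚ.∨-zeroʳ x)
insert-∪ʳ (suc j) (x ∷ s) (y ∷ u) = cong ((x ∨ y) ∷_) (insert-∪ʳ j s u)

insert-∪-insert : ∀ {m} (j : Fin m) (s u : Subset m) → insert j s ∪ insert j u ≡ insert j (s ∪ u)
insert-∪-insert j s u = begin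
  insert j s ∪ insert j u        ≡⟨ insert-∪ˡ j s (insert j u) ⟩
  insert j (s ∪ insert j u)      ≡⟨ cong (insert j) (insert-∪ʳ j s u) ⟩
  insert j (insert j (s ∪ u))    ≡⟨ Vecₚ.[]≔-idempotent (s ∪ u) j ⟩
  insert j (s ∪ u)               ∎
  where open ≡-Reasoning

∣∷∣≤∣true∷∣ : ∀ {m} x (v : Subset m) → ∣ x ∷ v ∣ ≤ ∣ true ∷ v ∣
∣∷∣≤∣true∷∣ true  v = ≤-refl
∣∷∣≤∣true∷∣ false v = n≤1+n _

missing : ∀ {m} (w : Subset m) → ∣ w ∣ < m → ∃ λ j → lookup w j ≡ false
missing (false ∷ w) _ = zero , refl
missing (true ∷ w) (s≤s ∣w∣<m) with missing w ∣w∣<m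
... | j , wⱼ = suc j , wⱼ

movable : ∀ {m} → Fin m → Subset (suc m) → Bool
movable j (x ∷ t) = x ∧ not (lookup t j)

moveTo : ∀ {m} → Fin m → Subset (suc m) → Subset (suc m)
moveTo j (x ∷ t) = false ∷ insert j t

movable-parts : ∀ {m} (j : Fin m) x t → movable j (x ∷ t) ≡ true → x ≡ true × lookup t j ≡ false
movable-parts j true t mv with lookup t j
movable-parts j true t () | true
movable-parts j true t mv | false = refl , refl

upShift : ∀ {m} → Fin m → List (Subset (suc m)) → List (Subset (suc m))
upShift j = Compression.compressAll (movable j) (moveTo j)

UpClosedAt : ∀ {m} → Fin m → List (Subset (suc m)) → Set
UpClosedAt j 𝒜 = ∀ {S} → S ∈ 𝒜 → movable j S ≡ true → moveTo j S ∈ 𝒜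

module UpShift {m : ℕ} (j : Fin m) where
  open Compression (movable j) (moveTo j)

  moved-immovable : ∀ S → movable j (moveTo j S) ≡ false
  moved-immovable (x ∷ t) = refl

  length-upShift : ∀ 𝒜 → length (upShift j 𝒜) ≡ length 𝒜
  length-upShift = length-compressAll

  unique-upShift : ∀ 𝒜 → Unique 𝒜 → Unique (upShift j 𝒜)
  unique-upShift = unique-compressAll injective
    where
      injective : ∀ {S T} → movable j S ≡ true → movable j T ≡ true → moveTo j S ≡ moveTo j T → S ≡ T
      injective {x ∷ s} {y ∷ t} mS mT eq with movable-parts j x s mS | movable-parts j y t mT
      ... | refl , sⱼ | refl , tⱼ = cong (true ∷_) (≡-via-clear j
            (trans (sym (clear-set j s true)) (trans (cong (clear j) (Vecₚ.∷-injectiveʳ eq)) (clear-set j t true)))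
            (trans sⱼ (sym tⱼ)))

  closes : ∀ 𝒜 → UpClosedAt j (upShift j 𝒜)
  closes 𝒜 = compressAll-pushed moved-immovable

  -- ... and keeps closure towards any other coordinate k: moved sets start
  -- with false, so they are neither movable towards k nor images of a move towards k.
  keeps : ∀ k {𝒜} → UpClosedAt k 𝒜 → UpClosedAt k (upShift j 𝒜)
  keeps k closed {X} X∈ mX with preimage X∈
  ... | inj₁ X∈𝒜 = stays-in (closed X∈𝒜 mX) (λ m → clash m (lemma X))
    where lemma : ∀ S → movable j (moveTo k S) ≡ false
          lemma (x ∷ t) = refl
  ... | inj₂ ((y ∷ s) , _ , _ , refl) = clash mX refl

  both-moved : ∀ {S T} → movable j S ≡ true → movable j T ≡ true → ∣ moveTo j S ∪ moveTo j T ∣ ≡ ∣ S ∪ T ∣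
  both-moved {x ∷ s} {y ∷ t} mS mT with movable-parts j x s mS | movable-parts j y t mT
  ... | refl , sⱼ | refl , tⱼ = trans (cong ∣_∣ (insert-∪-insert j s t))
          (∣insert∣ j (s ∪ t) (trans (lookup-∪ j s t) (cong₂ _∨_ sⱼ tⱼ)))

  -- Moving one set of a pair while the other stays creates no larger union:
  -- either the union shrinks, or it equals the union with the moved copy of
  -- the other set, which is in the family because the other set stayed.
  one-moved : ∀ {𝒜 d S T} → UnionBounded 𝒜 d → S ∈ 𝒜 → movable j S ≡ true →
    T ∈ 𝒜 → (movable j T ≡ true → moveTo j T ∈ 𝒜) → ∣ moveTo j S ∪ T ∣ ≤ d
  one-moved {d = d} {x ∷ s} {y ∷ u} bounded S∈ mS T∈ kept with movable-parts j x s mS | lookup u j in uⱼ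
  one-moved {d = d} {true ∷ s} {y ∷ u} bounded S∈ mS T∈ kept | refl , sⱼ | true =
    subst (λ w → ∣ y ∷ w ∣ ≤ d) (sym (trans (insert-∪ˡ j s u) (insert-present j (s ∪ u) sᵤⱼ)))
      (≤-trans (∣∷∣≤∣true∷∣ y (s ∪ u)) (bounded S∈ T∈))
    where sᵤⱼ = trans (lookup-∪ j s u) (trans (cong (lookup s j ∨_) uⱼ) (Boolₚ.∨-zeroʳ _))
  one-moved {d = d} {true ∷ s} {false ∷ u} bounded S∈ mS T∈ kept | refl , sⱼ | false =
    subst (_≤ d) (sym (trans (cong ∣_∣ (insert-∪ˡ j s u)) (∣insert∣ j (s ∪ u) (trans (lookup-∪ j s u) (cong₂ _∨_ sⱼ uⱼ)))))
      (bounded S∈ T∈)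
  one-moved {d = d} {true ∷ s} {true ∷ u} bounded S∈ mS T∈ kept | refl , sⱼ | false =
    subst (λ w → ∣ true ∷ w ∣ ≤ d) (trans (insert-∪ʳ j s u) (sym (insert-∪ˡ j s u)))
      (bounded S∈ (kept refl))

  unionBounded-upShift : ∀ {𝒜 d} → UnionBounded 𝒜 d → UnionBounded (upShift j 𝒜) d
  unionBounded-upShift {𝒜} {d} bounded S′∈ T′∈ with ∈-map⁻ (compress 𝒜) S′∈ | ∈-map⁻ (compress 𝒜) T′∈
  ... | S , S∈ , refl | T , T∈ , refl with outcome 𝒜 S | outcome 𝒜 T
  ... | stays eS _ | stays eT _ = subst₂ (λ a b → ∣ a ∪ b ∣ ≤ d) (sym eS) (sym eT) (bounded S∈ T∈)
  ... | moves eS mS _ | moves eT mT _ = subst₂ (λ a b → ∣ a ∪ b ∣ ≤ d) (sym eS) (sym eT)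
          (subst (_≤ d) (sym (both-moved {S} {T} mS mT)) (bounded S∈ T∈))
  ... | moves eS mS _ | stays eT pT = subst₂ (λ a b → ∣ a ∪ b ∣ ≤ d) (sym eS) (sym eT)
          (one-moved bounded S∈ mS T∈ pT)
  ... | stays eS pS | moves eT mT _ = subst₂ (λ a b → ∣ a ∪ b ∣ ≤ d) (sym eS) (sym eT)
          (subst (_≤ d) (cong ∣_∣ (∪-comm (moveTo j T) S)) (one-moved bounded T∈ mT S∈ pS))

kleitman : ℕ → ℕ → ℕ
kleitman n d = 2 ^ (d % 2) * choose≤ (n ∸ d % 2) (d / 2)

choose≤-suc : ∀ N k → choose≤ (suc N) (suc k) ≡ choose≤ N (suc k) + choose≤ N k
choose≤-suc N zero = trans (cong (1 +_) (sym (nCk+nC[k+1]≡[n+1]C[k+1] N 0))) (+-comm 1 (1 + N C 1))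
choose≤-suc N (suc k) = trans (cong₂ _+_ (choose≤-suc N k) (sym (nCk+nC[k+1]≡[n+1]C[k+1] N (suc k))))
  (solve 4 (λ a b c d → (a :+ b) :+ (c :+ d) := (a :+ d) :+ (b :+ c)) refl
     (choose≤ N (suc k)) (choose≤ N k) (N C suc k) (N C suc (suc k)))

choose≤-half : ∀ t → choose≤ (suc (t * 2)) t ≡ 2 ^ (t * 2)
choose≤-half zero = refl
choose≤-half (suc zero) = refl
choose≤-half (suc (suc t′)) = begin
    choose≤ (suc (suc N)) (suc t)
      ≡⟨ choose≤-suc (suc N) t ⟩
    choose≤ (suc N) (suc t) + choose≤ (suc N) t
      ≡⟨ cong₂ _+_ (choose≤-suc N t) (choose≤-suc N t′) ⟩
    ((a + c) + N C suc t + (a + c)) + ((a + c) + a)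
      ≡⟨ cong (λ z → ((a + c) + z + (a + c)) + ((a + c) + a)) (sym middle) ⟩
    ((a + c) + c + (a + c)) + ((a + c) + a)
      ≡⟨ solve 2 (λ a c → ((a :+ c) :+ c :+ (a :+ c)) :+ ((a :+ c) :+ a) := con 2 :* (con 2 :* (a :+ c))) refl a c ⟩
    2 * (2 * (a + c))
      ≡⟨ cong (λ z → 2 * (2 * z)) (choose≤-half (suc t′)) ⟩
    2 ^ (suc t * 2) ∎
  where
    open ≡-Reasoning
    t N a c : ℕ
    t = suc t′
    N = suc (t * 2)
    a = choose≤ N t′
    c = N C t
    t*2≡t+t : t * 2 ≡ t + t
    t*2≡t+t = trans (*-comm t 2) (cong (t +_) (+-identityʳ t))
    middle : N C t ≡ N C suc t
    middle = trans (nCk≡nC[n∸k] (≤-trans (m≤m+n t t) (≤-trans (≤-reflexive (sym t*2≡t+t)) (n≤1+n _))))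
               (cong (N C_) (trans (cong (_∸ t) (trans (cong suc t*2≡t+t) (+-comm (suc t) t))) (m+n∸m≡n t (suc t))))

kleitman-full : ∀ m → kleitman (suc m) m ≡ 2 ^ m
kleitman-full m with m % 2 in m%2 | m%n<n m 2
... | zero | _ = even m (m / 2) (trans (m≡m%n+[m/n]*n m 2) (cong (_+ (m / 2) * 2) m%2))
  where
    even : ∀ m t → m ≡ t * 2 → 1 * choose≤ (suc m ∸ 0) t ≡ 2 ^ m
    even _ t refl = trans (*-identityˡ _) (choose≤-half t)
... | suc zero | _ = odd m (m / 2) (trans (m≡m%n+[m/n]*n m 2) (cong (_+ (m / 2) * 2) m%2))
  where
    odd : ∀ m t → m ≡ suc (t * 2) → 2 ^ 1 * choose≤ (suc m ∸ 1) t ≡ 2 ^ m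
    odd _ t refl = cong (2 *_) (choose≤-half t)
... | suc (suc _) | s≤s (s≤s ())

kleitman-suc : ∀ m e → 1 ≤ m → kleitman (suc m) (suc (suc e)) ≡ kleitman m (suc (suc e)) + kleitman m e
kleitman-suc m e 1≤m = begin
    p * choose≤ (suc m ∸ r) (suc (suc e) / 2)
      ≡⟨ cong₂ (λ u v → p * choose≤ u v) (+-∸-assoc 1 r≤m) (half-suc-suc e) ⟩
    p * choose≤ (suc (m ∸ r)) (suc t)
      ≡⟨ cong (p *_) (choose≤-suc (m ∸ r) t) ⟩
    p * (choose≤ (m ∸ r) (suc t) + choose≤ (m ∸ r) t)
      ≡⟨ *-distribˡ-+ p (choose≤ (m ∸ r) (suc t)) _ ⟩
    p * choose≤ (m ∸ r) (suc t) + p * choose≤ (m ∸ r) t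
      ≡⟨ cong (λ v → p * choose≤ (m ∸ r) v + p * choose≤ (m ∸ r) t) (sym (half-suc-suc e)) ⟩
    kleitman m (suc (suc e)) + kleitman m e ∎
  where
    open ≡-Reasoning
    r p t : ℕ
    r = e % 2
    p = 2 ^ r
    t = e / 2
    r≤m : r ≤ m
    r≤m = ≤-trans (≤-pred (m%n<n e 2)) 1≤m
    half-suc-suc : ∀ e → suc (suc e) / 2 ≡ suc (e / 2)
    half-suc-suc e = m/n≡1+[m∸n]/n {suc (suc e)} {2} (s≤s (s≤s z≤n))

upShiftAll : ∀ {m} → List (Subset (suc m)) → List (Subset (suc m))
upShiftAll {m} = iterate upShift (allFin m)

module _ {m : ℕ} where
  open UpShift

  length-upShiftAll : ∀ (𝒜 : List (Subset (suc m))) → length (upShiftAll 𝒜) ≡ length 𝒜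
  length-upShiftAll 𝒜 = iterate-invariant upShift (λ ℬ → length ℬ ≡ length 𝒜)
    (λ j {ℬ} eq → trans (length-upShift j ℬ) eq) (allFin m) refl

  unique-upShiftAll : ∀ (𝒜 : List (Subset (suc m))) → Unique 𝒜 → Unique (upShiftAll 𝒜)
  unique-upShiftAll 𝒜 = iterate-invariant upShift Unique (λ j {ℬ} → unique-upShift j ℬ) (allFin m)

  unionBounded-upShiftAll : ∀ {𝒜 : List (Subset (suc m))} {d} → UnionBounded 𝒜 d → UnionBounded (upShiftAll 𝒜) d
  unionBounded-upShiftAll {d = d} =
    iterate-invariant upShift (λ ℬ → UnionBounded ℬ d) (λ j → unionBounded-upShift j) (allFin m)

  upClosed-upShiftAll : ∀ (𝒜 : List (Subset (suc m))) j → UpClosedAt j (upShiftAll 𝒜)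
  upClosed-upShiftAll 𝒜 j = iterate-stable upShift UpClosedAt closes (λ i k → keeps i k) (allFin m) 𝒜 (∈-allFin j)

-- In an up-closed family with unions bounded by d ≤ m, two sets through the
-- first point have unions of size at most d - 2 off that point: if s ∪ t misses
-- j, then true ∷ s and the moved copy false ∷ insert j t of true ∷ t have a
-- union of size |s ∪ t| + 2.
section-true-bound : ∀ {m d} {𝒜 : List (Subset (suc m))} → (∀ j → UpClosedAt j 𝒜) →
  UnionBounded 𝒜 d → d ≤ m → ∀ {s t} → s ∈ section true 𝒜 → t ∈ section true 𝒜 → suc (suc ∣ s ∪ t ∣) ≤ d
section-true-bound {d = d} closed bounded d≤m {s} {t} s∈ t∈
  with missing (s ∪ t) (≤-trans (bounded (∈-section true s∈) (∈-section true t∈)) d≤m)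
... | j , s∪t∌j = subst (λ z → suc z ≤ d) size
        (bounded (∈-section true s∈) (closed j (∈-section true t∈) (cong not t∌j)))
  where
    ∨-false : ∀ a b → a ∨ b ≡ false → b ≡ false
    ∨-false false b eq = eq
    t∌j : lookup t j ≡ false
    t∌j = ∨-false (lookup s j) (lookup t j) (trans (sym (lookup-∪ j s t)) s∪t∌j)
    size : ∣ s ∪ insert j t ∣ ≡ suc ∣ s ∪ t ∣
    size = trans (cong ∣_∣ (insert-∪ʳ j s t)) (∣insert∣ j (s ∪ t) s∪t∌j)

length-only-false : ∀ {m} (ℬ : List (Subset (suc m))) → (∀ {s} → s ∈ section true ℬ → ⊥) →
  length ℬ ≡ length (section false ℬ)
length-only-false ℬ none = trans (length-sections ℬ) (trans (cong (length (section false ℬ) +_) (empty (section true ℬ) none)) (+-identityʳ _))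
  where
    empty : ∀ {A : Set} (xs : List A) → (∀ {x} → x ∈ xs → ⊥) → length xs ≡ 0
    empty [] _ = refl
    empty (x ∷ xs) none = ⊥-elim (none (here refl))

bounded-false : ∀ {m d} (ℬ : List (Subset (suc m))) → UnionBounded ℬ d → UnionBounded (section false ℬ) d
bounded-false ℬ bounded s∈ t∈ = bounded (∈-section false s∈) (∈-section false t∈)

mutual
  kleitman-bound : ∀ m d → d ≤ m → (𝒜 : List (Subset (suc m))) → Unique 𝒜 → UnionBounded 𝒜 d →
    length 𝒜 ≤ kleitman (suc m) d
  kleitman-bound m d d≤m 𝒜 𝒜! bounded with d ≟ m
  ... | yes refl = subst (length 𝒜 ≤_) (sym (kleitman-full d)) (unionBounded-full d 𝒜 𝒜! bounded)
  ... | no d≢m with ≤∧≢⇒< d≤m d≢m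
  ...   | s≤s d≤m′ = subst (_≤ kleitman (suc m) d) (length-upShiftAll 𝒜)
            (kleitman-step _ d d≤m′ (upShiftAll 𝒜) (unique-upShiftAll 𝒜 𝒜!)
              (unionBounded-upShiftAll bounded) (upClosed-upShiftAll 𝒜))

  -- The inductive step for an up-closed family: split by the first point; the
  -- section at false is bounded by d, the section at true by d - 2.
  kleitman-step : ∀ m d → d ≤ m → (ℬ : List (Subset (suc (suc m)))) → Unique ℬ → UnionBounded ℬ d →
    (∀ j → UpClosedAt j ℬ) → length ℬ ≤ kleitman (suc (suc m)) d
  kleitman-step m zero _ ℬ ℬ! bounded closed =
    ≤-trans (≤-reflexive (length-only-false ℬ (λ s∈ → none (section-true-bound closed bounded z≤n s∈ s∈))))
            (kleitman-bound m 0 z≤n (section false ℬ) (unique-section false ℬ ℬ!) (bounded-false ℬ bounded))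
    where none : ∀ {x} → suc (suc x) ≤ 0 → ⊥
          none ()
  kleitman-step m (suc zero) 1≤m ℬ ℬ! bounded closed =
    ≤-trans (≤-reflexive (length-only-false ℬ (λ s∈ → none (section-true-bound closed bounded (s≤s z≤n) s∈ s∈))))
            (kleitman-bound m 1 1≤m (section false ℬ) (unique-section false ℬ ℬ!) (bounded-false ℬ bounded))
    where none : ∀ {x} → suc (suc x) ≤ 1 → ⊥
          none (s≤s ())
  kleitman-step m (suc (suc e)) d≤m ℬ ℬ! bounded closed = begin
      length ℬ                                                ≡⟨ length-sections ℬ ⟩
      length (section false ℬ) + length (section true ℬ)      ≤⟨ +-mono-≤ bound₀ bound₁ ⟩
      kleitman (suc m) (suc (suc e)) + kleitman (suc m) e     ≡⟨ sym (kleitman-suc (suc m) e (s≤s z≤n)) ⟩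
      kleitman (suc (suc m)) (suc (suc e))                    ∎
    where
      open ≤-Reasoning
      bound₀ : length (section false ℬ) ≤ kleitman (suc m) (suc (suc e))
      bound₀ = kleitman-bound m (suc (suc e)) d≤m (section false ℬ) (unique-section false ℬ ℬ!) (bounded-false ℬ bounded)
      bound₁ : length (section true ℬ) ≤ kleitman (suc m) e
      bound₁ = kleitman-bound m e (≤-trans (n≤1+n e) (≤-trans (n≤1+n (suc e)) d≤m)) (section true ℬ)
                 (unique-section true ℬ ℬ!)
                 (λ s∈ t∈ → ≤-pred (≤-pred (section-true-bound closed bounded (≤-trans d≤m (n≤1+n m)) s∈ t∈)))

theorem2 : (n d r : ℕ) → 1 ≤ d → d < n → r ≤ 1 → d % 2 ≡ r
    → (𝒜 : List (Subset n)) → Unique 𝒜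
    → VC≤ (λ U → U ∈△△ 𝒜) d
    → length 𝒜 ≤ 2 ^ r * choose≤ (n ∸ r) (d / 2)
theorem2 zero d r _ () _ _ _ _ _
theorem2 (suc m) d .(d % 2) _ d<n _ refl 𝒜 𝒜! vc = begin
  length 𝒜            ≡⟨ sym (length-downShiftAll 𝒜) ⟩
  length ℬ            ≤⟨ kleitman-bound m d (≤-pred d<n) ℬ (unique-downShiftAll 𝒜 𝒜!) unionBounded ⟩
  kleitman (suc m) d  ∎
  where
    open ≤-Reasoning
    ℬ : List (Subset (suc m))
    ℬ = downShiftAll 𝒜
    unionBounded : UnionBounded ℬ d
    unionBounded = unionBounded-fromVC (downClosed-downShiftAll 𝒜) (vc-downShiftAll vc)
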